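{- For every $\mathbf{k}\in\mathbb{N}[\Phi]^W$, the relations $\to_{\mathrm{sym},\mathbf{k}}$ and $\to_{\mathrm{tr},\mathbf{k}}$ on $P$ are terminating, i.e., there is no infinite sequence $\lambda_0\to\lambda_1\to\lambda_2\to\cdots$ for either relation.
   Context: Let $V$ be a finite-dimensional real inner product space and $\Phi\subseteq V$ an irreducible (reduced, crystallographic) root system spanning $V$, with $\alpha^\vee=2\alpha/\langle\alpha,\alpha\rangle$, simple roots $\alpha_1,\dots,\alpha_n$, positive roots $\Phi^+$, Weyl group $W$, fundamental weights $\omega_i$ ($\langle\omega_i,\alpha_j^\vee\rangle=\delta_{ij}$), weight lattice $P=\bigoplus\mathbb{Z}\omega_i$. $\mathbb{N}[\Phi]^W$ is the set of $W$-invariant functions $\mathbf{k}\colon\Phi\to\mathbb{Z}_{\ge0}$. The symmetric relation: $\lambda\to_{\mathrm{sym},\mathbf{k}}\lambda+\alpha$ for $\lambda\in P$, $\alpha\in\Phi^+$ with $\langle\lambda,\alpha^\vee\rangle+1\in\{ -\mathbf{k}(\alpha),\dots,\mathbf{k}(\alpha)\}$; the truncated relation: $\lambda\to_{\mathrm{tr},\mathbf{k}}\lambda+\alpha$ for $\alpha\in\Phi^+$ with $\langle\lambda,\alpha^\vee\rangle+1\in\{ -\mathbf{k}(\alpha)+1,\dots,\mathbf{k}(\alpha)\}$.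
   Formalization: The space V is ℚ^n, with its inner product given by a symmetric positive-definite rational Gram matrix, instead of a finite-dimensional real inner product space. -}

module Defs where

open import Data.Nat using (ℕ; zero; suc)
open import Data.Integer as ℤ using (ℤ; +_)
open import Data.Rational as ℚ using (ℚ; 0ℚ; 1ℚ; _/_; _÷_; _*_; _+_; _-_; -_; _<_)
open import Data.Rational.Properties using (_≟_)
open import Data.Fin using (Fin; zero; suc)
open import Data.Vec using (Vec; zipWith; map; replicate; lookup)
open import Data.List using (List; []; _∷_; foldr)
open import Data.List.Membership.Propositional using (_∈_)
open import Data.List.Relation.Unary.All using (All)
open import Data.Bool using (Bool; true; false)
open import Data.Product using (Σ; ∃; _×_; _,_)
open import Data.Sum using (_⊎_)
open import Relation.Nullary using (¬_; yes; no)
open import Relation.Binary.PropositionalEquality using (_≡_; _≢_)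

-- The ambient space V = ℚⁿ (a rational model suffices).

V : ℕ → Set
V n = Vec ℚ n

Σᶠ : ∀ {n} → (Fin n → ℚ) → ℚ
Σᶠ {zero}  f = 0ℚ
Σᶠ {suc n} f = f zero + Σᶠ (λ i → f (suc i))

_⊕_ : ∀ {n} → V n → V n → V n
_⊕_ = zipWith _+_

_·_ : ∀ {n} → ℚ → V n → V n
c · v = map (c *_) v

zeroV : ∀ n → V n
zeroV n = replicate n 0ℚ

ℤ→ℚ : ℤ → ℚ
ℤ→ℚ m = m / 1

ℕ→ℚ : ℕ → ℚ
ℕ→ℚ m = (+ m) / 1

linFin : ∀ {n m} → (Fin m → ℚ) → (Fin m → V n) → V n
linFin {n} {zero}  c v = zeroV n
linFin {n} {suc m} c v = (c zero · v zero) ⊕ linFin (λ i → c (suc i)) (λ i → v (suc i))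

linList : ∀ {n} → List ℚ → List (V n) → V n
linList {n} []       _        = zeroV n
linList {n} (_ ∷ _)  []       = zeroV n
linList {n} (c ∷ cs) (v ∷ vs) = (c · v) ⊕ linList cs vs

module InnerProduct {n : ℕ} (B : Fin n → Fin n → ℚ) where

  ⟪_,_⟫ : V n → V n → ℚ
  ⟪ x , y ⟫ = Σᶠ (λ i → Σᶠ (λ j → lookup x i * B i j * lookup y j))

  -- ⟨x , α^∨⟩ = 2⟨x,α⟩/⟨α,α⟩  (α^∨ = 2α/⟨α,α⟩); set to 0 when α = 0 (never used)
  ⟨_,_∨⟩ : V n → V n → ℚ
  ⟨ x , α ∨⟩ with ⟪ α , α ⟫ ≟ 0ℚ
  ... | yes _ = 0ℚ
  ... | no ne = ((+ 2 / 1) * ⟪ x , α ⟫) ÷ ⟪ α , α ⟫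
    where instance _ = ℚ.≢-nonZero ne

  s : V n → V n → V n
  s α x = x ⊕ ((- ⟨ x , α ∨⟩) · α)

  -- a Weyl group element as a word in reflections s_{β₁} ∘ ⋯ ∘ s_{βₖ}
  act : List (V n) → V n → V n
  act w x = foldr s x w

record RootSystem (n : ℕ) : Set where
  field
    B       : Fin n → Fin n → ℚ
  open InnerProduct B public
  field
    B-sym     : ∀ i j → B i j ≡ B j i
    B-posdef  : ∀ (x : V n) → x ≢ zeroV n → 0ℚ < ⟪ x , x ⟫
    Φ         : List (V n)
    0∉Φ       : ¬ (zeroV n ∈ Φ)
    spans     : ∀ (v : V n) → ∃ λ (cs : List ℚ) → v ≡ linList cs Φ
    refl-closed : ∀ {α β} → α ∈ Φ → β ∈ Φ → s α β ∈ Φ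
    crystallographic : ∀ {α β} → α ∈ Φ → β ∈ Φ → ∃ λ (m : ℤ) → ⟨ β , α ∨⟩ ≡ ℤ→ℚ m
    reduced   : ∀ {α} (c : ℚ) → α ∈ Φ → (c · α) ∈ Φ → c ≡ 1ℚ ⊎ c ≡ - 1ℚ
    irreducible : ∀ (f : V n → Bool) →
                  (∃ λ α → α ∈ Φ × f α ≡ true) →
                  (∃ λ β → β ∈ Φ × f β ≡ false) →
                  ∃ λ α → ∃ λ β → α ∈ Φ × β ∈ Φ × f α ≡ true × f β ≡ false × ⟪ α , β ⟫ ≢ 0ℚ
    Δ         : Fin n → V n
    Δ⊆Φ       : ∀ i → Δ i ∈ Φ

  IsPositive : V n → Set
  IsPositive β = ∃ λ (c : Fin n → ℕ) → β ≡ linFin (λ i → ℕ→ℚ (c i)) Δ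

  field
    Δ-base    : ∀ {β} → β ∈ Φ → IsPositive β ⊎ IsPositive ((- 1ℚ) · β)

  Φ⁺ : V n → Set
  Φ⁺ β = β ∈ Φ × IsPositive β

  IsWeylWord : List (V n) → Set
  IsWeylWord w = All (_∈ Φ) w

  IsFundamentalWeights : (Fin n → V n) → Set
  IsFundamentalWeights ω =
    ∀ i j → (i ≡ j → ⟨ ω i , Δ j ∨⟩ ≡ 1ℚ) × (i ≢ j → ⟨ ω i , Δ j ∨⟩ ≡ 0ℚ)

  -- W-invariant multiplicity functions k ∈ ℕ[Φ]^W (values off Φ irrelevant)
  IsWInvariant : (V n → ℕ) → Set
  IsWInvariant k = ∀ w → IsWeylWord w → ∀ {β} → β ∈ Φ → k (act w β) ≡ k β

  InP : (Fin n → V n) → V n → Set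
  InP ω λ' = ∃ λ (m : Fin n → ℤ) → λ' ≡ linFin (λ i → ℤ→ℚ (m i)) ω

  SymStep : (V n → ℕ) → V n → V n → Set
  SymStep k λ' μ = ∃ λ α → Φ⁺ α × μ ≡ λ' ⊕ α ×
    ∃ λ (m : ℤ) → ⟨ λ' , α ∨⟩ ≡ ℤ→ℚ m ×
      (ℤ.- (+ k α) ℤ.≤ m ℤ.+ + 1) × (m ℤ.+ + 1 ℤ.≤ + k α)

  TrStep : (V n → ℕ) → V n → V n → Set
  TrStep k λ' μ = ∃ λ α → Φ⁺ α × μ ≡ λ' ⊕ α ×
    ∃ λ (m : ℤ) → ⟨ λ' , α ∨⟩ ≡ ℤ→ℚ m ×
      (ℤ.- (+ k α) ℤ.+ + 1 ℤ.≤ m ℤ.+ + 1) × (m ℤ.+ + 1 ℤ.≤ + k α)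

  TerminatingOnP : (Fin n → V n) → (V n → V n → Set) → Set
  TerminatingOnP ω R =
    ¬ (∃ λ (seq : ℕ → V n) → (∀ i → InP ω (seq i)) × (∀ i → R (seq i) (seq (suc i))))

module Submission where

-- Both relations only ever step λ → λ + α with α a positive root and
-- ⟨λ,α^∨⟩ + 1 ≤ k(α); this upper bound alone forces termination.
-- Let η be the covector of the height function, η = Σᵢ ωᵢ / ⟨ωᵢ,αᵢ⟩, so that
-- ⟨αⱼ,η⟩ = 1 for every simple root and ⟨α,η⟩ ≥ 1 for every positive root.
-- Put C = Σ_{β∈Φ} |β|² k(β), M = C + 1 and consider the potential
--   G(x) = |x - Mη|² ≥ 0.
-- A step λ → λ + α changes it by 2⟨λ,α⟩ + |α|² - 2M⟨α,η⟩
--   = |α|²(⟨λ,α^∨⟩ + 1) - 2M ht(α) ≤ C - 2M ≤ -1,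
-- so G drops by at least 1 at every step, and a nonnegative rational
-- quantity cannot do so infinitely often (Archimedean property).

open import Defs
open import Data.Nat as ℕ using (ℕ; zero; suc)
import Data.Nat.Properties as ℕP
import Data.Nat.Coprimality as Coprimality
open import Data.Integer as ℤ using (ℤ; +_; -[1+_])
import Data.Integer.Properties as ℤP
open import Data.Rational as ℚ using (ℚ; mkℚ; 0ℚ; 1ℚ; ½; _+_; _*_; -_; _-_; _≤_; _<_; 1/_)
import Data.Rational.Properties as ℚP
open import Data.Rational.Solver using (module +-*-Solver)
open import Data.Fin using (Fin; zero; suc)
import Data.Fin.Properties as FinP
open import Data.Vec using ([]; _∷_; lookup)
import Data.Vec.Properties as VecP
open import Data.List using (List; []; _∷_)
open import Data.List.Membership.Propositional using (_∈_)
open import Data.List.Relation.Unary.Any using (here; there)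
open import Data.Product using (∃; _×_; _,_; proj₁; proj₂)
open import Data.Sum using (_⊎_; inj₁; inj₂)
open import Data.Empty using (⊥-elim)
open import Function using (_∘_)
open import Relation.Nullary using (¬_; yes; no)
open import Relation.Binary.PropositionalEquality

open +-*-Solver

0≤+ : ∀ {p q} → 0ℚ ≤ p → 0ℚ ≤ q → 0ℚ ≤ p + q
0≤+ = ℚP.+-mono-≤

0≤* : ∀ {p q} → 0ℚ ≤ p → 0ℚ ≤ q → 0ℚ ≤ p * q
0≤* {p} {q} p≥0 q≥0 =
  ℚP.nonNegative⁻¹ (p * q) {{ℚP.nonNeg*nonNeg⇒nonNeg p {{ℚ.nonNegative p≥0}} q {{ℚ.nonNegative q≥0}}}}

≤-+-nonneg : ∀ {p q} → 0ℚ ≤ q → p ≤ p + q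
≤-+-nonneg {p} {q} q≥0 = subst (_≤ p + q) (ℚP.+-identityʳ p) (ℚP.+-monoʳ-≤ p q≥0)

≤-+-nonnegˡ : ∀ {p q} → 0ℚ ≤ q → p ≤ q + p
≤-+-nonnegˡ {p} {q} q≥0 = subst (p ≤_) (ℚP.+-comm p q) (≤-+-nonneg q≥0)

≤⇒0≤- : ∀ {p q} → p ≤ q → 0ℚ ≤ q - p
≤⇒0≤- {p} {q} p≤q = subst (_≤ q - p) (ℚP.+-inverseʳ p) (ℚP.+-monoˡ-≤ (- p) p≤q)

0≤-⇒≤ : ∀ {p q} → 0ℚ ≤ q - p → p ≤ q
0≤-⇒≤ {p} {q} d≥0 =
  subst₂ _≤_ (ℚP.+-identityˡ p) (solve 2 (λ p q → (q :- p) :+ p := q) refl p q) (ℚP.+-monoˡ-≤ p d≥0)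

double≡0⇒≡0 : ∀ {p} → p + p ≡ 0ℚ → p ≡ 0ℚ
double≡0⇒≡0 {p} p+p≡0 = begin
  p            ≡⟨ solve 1 (λ p → p := con ½ :* (p :+ p)) refl p ⟩
  ½ * (p + p)  ≡⟨ cong (½ *_) p+p≡0 ⟩
  ½ * 0ℚ       ≡⟨ ℚP.*-zeroʳ ½ ⟩
  0ℚ           ∎
  where open ≡-Reasoning

coprime-1 : ∀ a → Coprimality.Coprime a 1
coprime-1 a = Coprimality.sym (Coprimality.1-coprimeTo a)

ℤ→ℚ-mkℚ : ∀ m → ℤ→ℚ m ≡ mkℚ m 0 (coprime-1 ℤ.∣ m ∣)
ℤ→ℚ-mkℚ (+ a)    = ℚP.normalize-coprime (coprime-1 a)
ℤ→ℚ-mkℚ -[1+ a ] = cong -_ (ℚP.normalize-coprime (coprime-1 (suc a)))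

ℤ→ℚ-+ : ∀ a b → ℤ→ℚ a + ℤ→ℚ b ≡ ℤ→ℚ (a ℤ.+ b)
ℤ→ℚ-+ a b rewrite ℤ→ℚ-mkℚ a | ℤ→ℚ-mkℚ b =
  ℚP./-cong {a ℤ.* + 1 ℤ.+ b ℤ.* + 1} {1} {a ℤ.+ b} {1}
    (cong₂ ℤ._+_ (ℤP.*-identityʳ a) (ℤP.*-identityʳ b)) refl

ℤ→ℚ-mono : ∀ {a b} → a ℤ.≤ b → ℤ→ℚ a ≤ ℤ→ℚ b
ℤ→ℚ-mono {a} {b} a≤b rewrite ℤ→ℚ-mkℚ a | ℤ→ℚ-mkℚ b =
  ℚ.*≤* (subst₂ ℤ._≤_ (sym (ℤP.*-identityʳ a)) (sym (ℤP.*-identityʳ b)) a≤b)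

ℕ→ℚ-suc : ∀ i → ℕ→ℚ (suc i) ≡ ℕ→ℚ i + 1ℚ
ℕ→ℚ-suc i = sym (trans (ℤ→ℚ-+ (+ i) (+ 1)) (cong ℤ→ℚ (ℤP.+-comm (+ i) (+ 1))))

ℕ→ℚ-nonneg : ∀ i → 0ℚ ≤ ℕ→ℚ i
ℕ→ℚ-nonneg i = ℤ→ℚ-mono {+ 0} {+ i} (ℤ.+≤+ ℕ.z≤n)

ℕ→ℚ-suc-≥1 : ∀ i → 1ℚ ≤ ℕ→ℚ (suc i)
ℕ→ℚ-suc-≥1 i = ℤ→ℚ-mono {+ 1} {+ suc i} (ℤ.+≤+ (ℕ.s≤s ℕ.z≤n))

archimedean : ∀ q → ∃ λ N → q < ℕ→ℚ N
archimedean q@(mkℚ num d _) = N , subst (q <_) (sym (ℤ→ℚ-mkℚ (+ N))) (ℚ.*<* num<N)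
  where
  N = suc ℤ.∣ num ∣
  num≤∣num∣ : ∀ m → m ℤ.≤ + ℤ.∣ m ∣
  num≤∣num∣ (+ _)    = ℤP.≤-refl
  num≤∣num∣ -[1+ _ ] = ℤ.-≤+
  num<N : num ℤ.* + 1 ℤ.< + N ℤ.* + suc d
  num<N = subst (ℤ._< + N ℤ.* + suc d) (sym (ℤP.*-identityʳ num))
    (ℤP.≤-<-trans (num≤∣num∣ num) (ℤ.+<+ (ℕP.<-≤-trans (ℕP.n<1+n _) (ℕP.m≤m*n N (suc d)))))

Σᶠ-cong : ∀ {m} {f g : Fin m → ℚ} → (∀ i → f i ≡ g i) → Σᶠ f ≡ Σᶠ g
Σᶠ-cong {zero}  f≡g = refl
Σᶠ-cong {suc m} f≡g = cong₂ _+_ (f≡g zero) (Σᶠ-cong (f≡g ∘ suc))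

Σᶠ-0 : ∀ {m} → Σᶠ {m} (λ _ → 0ℚ) ≡ 0ℚ
Σᶠ-0 {zero}  = refl
Σᶠ-0 {suc m} = trans (cong (λ t → 0ℚ + t) (Σᶠ-0 {m})) (ℚP.+-identityʳ 0ℚ)

Σᶠ-+ : ∀ {m} (f g : Fin m → ℚ) → Σᶠ (λ i → f i + g i) ≡ Σᶠ f + Σᶠ g
Σᶠ-+ {zero}  f g = refl
Σᶠ-+ {suc m} f g = trans (cong (λ t → f zero + g zero + t) (Σᶠ-+ (f ∘ suc) (g ∘ suc)))
  (solve 4 (λ a b c d → (a :+ b) :+ (c :+ d) := (a :+ c) :+ (b :+ d)) refl
     (f zero) (g zero) (Σᶠ (f ∘ suc)) (Σᶠ (g ∘ suc)))

Σᶠ-* : ∀ {m} c (f : Fin m → ℚ) → Σᶠ (λ i → c * f i) ≡ c * Σᶠ f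
Σᶠ-* {zero}  c f = sym (ℚP.*-zeroʳ c)
Σᶠ-* {suc m} c f = trans (cong (λ t → c * f zero + t) (Σᶠ-* c (f ∘ suc)))
  (sym (ℚP.*-distribˡ-+ c (f zero) (Σᶠ (f ∘ suc))))

Σᶠ-swap : ∀ {a b} (f : Fin a → Fin b → ℚ) →
  Σᶠ (λ i → Σᶠ (λ j → f i j)) ≡ Σᶠ (λ j → Σᶠ (λ i → f i j))
Σᶠ-swap {zero}  {b} f = sym (Σᶠ-0 {b})
Σᶠ-swap {suc a}     f = trans (cong (λ t → Σᶠ (f zero) + t) (Σᶠ-swap (f ∘ suc)))
  (sym (Σᶠ-+ (f zero) (λ j → Σᶠ (λ i → f (suc i) j))))

Σᶠ-single : ∀ {m} (f : Fin m → ℚ) j → (∀ i → i ≢ j → f i ≡ 0ℚ) → Σᶠ f ≡ f j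
Σᶠ-single {suc m} f zero off = begin
  f zero + Σᶠ (f ∘ suc)  ≡⟨ cong (λ t → f zero + t) (trans (Σᶠ-cong (λ i → off (suc i) (λ ()))) (Σᶠ-0 {m})) ⟩
  f zero + 0ℚ            ≡⟨ ℚP.+-identityʳ (f zero) ⟩
  f zero                 ∎
  where open ≡-Reasoning
Σᶠ-single {suc m} f (suc j) off = begin
  f zero + Σᶠ (f ∘ suc)  ≡⟨ cong₂ _+_ (off zero (λ ())) (Σᶠ-single (f ∘ suc) j off∘suc) ⟩
  0ℚ + f (suc j)         ≡⟨ ℚP.+-identityˡ (f (suc j)) ⟩
  f (suc j)              ∎
  where
  open ≡-Reasoning
  off∘suc : ∀ i → i ≢ j → f (suc i) ≡ 0ℚ
  off∘suc i i≢j = off (suc i) (i≢j ∘ FinP.suc-injective)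

Σᶠ-nonneg : ∀ {m} (f : Fin m → ℚ) → (∀ i → 0ℚ ≤ f i) → 0ℚ ≤ Σᶠ f
Σᶠ-nonneg {zero}  f f≥0 = ℚP.≤-refl
Σᶠ-nonneg {suc m} f f≥0 = 0≤+ (f≥0 zero) (Σᶠ-nonneg (f ∘ suc) (f≥0 ∘ suc))

Σᶠ-ℕ-≥1-or-zero : ∀ {m} (c : Fin m → ℕ) →
  1ℚ ≤ Σᶠ (λ i → ℕ→ℚ (c i)) ⊎ (∀ i → c i ≡ 0)
Σᶠ-ℕ-≥1-or-zero {zero}  c = inj₂ (λ ())
Σᶠ-ℕ-≥1-or-zero {suc m} c = by-head (c zero) refl (Σᶠ-ℕ-≥1-or-zero (c ∘ suc))
  where
  rest = Σᶠ (λ i → ℕ→ℚ (c (suc i)))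
  by-head : ∀ c₀ → c zero ≡ c₀ → 1ℚ ≤ rest ⊎ (∀ i → c (suc i) ≡ 0) →
            1ℚ ≤ ℕ→ℚ (c zero) + rest ⊎ (∀ i → c i ≡ 0)
  by-head (suc a) eq _ = inj₁ (subst (λ t → 1ℚ ≤ ℕ→ℚ t + rest) (sym eq)
    (ℚP.≤-trans (ℕ→ℚ-suc-≥1 a) (≤-+-nonneg (Σᶠ-nonneg _ (ℕ→ℚ-nonneg ∘ c ∘ suc)))))
  by-head zero eq (inj₁ rest≥1) = inj₁ (subst (λ t → 1ℚ ≤ ℕ→ℚ t + rest) (sym eq)
    (subst (1ℚ ≤_) (sym (ℚP.+-identityˡ rest)) rest≥1))
  by-head zero eq (inj₂ rest≡0) = inj₂ λ { zero → eq ; (suc i) → rest≡0 i }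

Σˡ : {A : Set} → (A → ℚ) → List A → ℚ
Σˡ f []       = 0ℚ
Σˡ f (x ∷ xs) = f x + Σˡ f xs

Σˡ-nonneg : {A : Set} (f : A → ℚ) → (∀ x → 0ℚ ≤ f x) → ∀ xs → 0ℚ ≤ Σˡ f xs
Σˡ-nonneg f f≥0 []       = ℚP.≤-refl
Σˡ-nonneg f f≥0 (x ∷ xs) = 0≤+ (f≥0 x) (Σˡ-nonneg f f≥0 xs)

term≤Σˡ : {A : Set} (f : A → ℚ) → (∀ x → 0ℚ ≤ f x) → ∀ {x xs} → x ∈ xs → f x ≤ Σˡ f xs
term≤Σˡ f f≥0 {xs = _ ∷ ys} (here refl) = ≤-+-nonneg (Σˡ-nonneg f f≥0 ys)
term≤Σˡ f f≥0 {xs = y ∷ _} (there x∈) = ℚP.≤-trans (term≤Σˡ f f≥0 x∈) (≤-+-nonnegˡ (f≥0 y))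

no-infinite-descent : {A : Set} (R : A → A → Set) (G : A → ℚ) → (∀ x → 0ℚ ≤ G x) →
  (∀ {x y} → R x y → G y + 1ℚ ≤ G x) →
  ¬ (∃ λ (seq : ℕ → A) → ∀ i → R (seq i) (seq (suc i)))
no-infinite-descent R G G≥0 drop (seq , chain) =
  ℚP.<-irrefl refl (ℚP.<-≤-trans (proj₂ N-large) (index≤G₀ (proj₁ N-large)))
  where
  open ℚP.≤-Reasoning
  dropped : ∀ i → G (seq i) + ℕ→ℚ i ≤ G (seq 0)
  dropped zero    = ℚP.≤-reflexive (ℚP.+-identityʳ _)
  dropped (suc i) = begin
    G (seq (suc i)) + ℕ→ℚ (suc i)    ≡⟨ cong (λ t → G (seq (suc i)) + t) (ℕ→ℚ-suc i) ⟩
    G (seq (suc i)) + (ℕ→ℚ i + 1ℚ)   ≡⟨ solve 2 (λ g i → g :+ (i :+ con 1ℚ) := g :+ con 1ℚ :+ i) refl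
                                          (G (seq (suc i))) (ℕ→ℚ i) ⟩
    G (seq (suc i)) + 1ℚ + ℕ→ℚ i     ≤⟨ ℚP.+-monoˡ-≤ (ℕ→ℚ i) (drop (chain i)) ⟩
    G (seq i) + ℕ→ℚ i                ≤⟨ dropped i ⟩
    G (seq 0)                        ∎
  index≤G₀ : ∀ i → ℕ→ℚ i ≤ G (seq 0)
  index≤G₀ i = ℚP.≤-trans (≤-+-nonnegˡ (G≥0 (seq i))) (dropped i)
  N-large = archimedean (G (seq 0))

module Bilinear {n : ℕ} (B : Fin n → Fin n → ℚ) where
  open InnerProduct B

  ⟪⟫-distribˡ-⊕ : ∀ x y z → ⟪ x ⊕ y , z ⟫ ≡ ⟪ x , z ⟫ + ⟪ y , z ⟫
  ⟪⟫-distribˡ-⊕ x y z =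
    trans (Σᶠ-cong λ i → trans (Σᶠ-cong (entry i)) (Σᶠ-+ (term x i) (term y i)))
          (Σᶠ-+ (λ i → Σᶠ (term x i)) (λ i → Σᶠ (term y i)))
    where
    term : ∀ u i j → ℚ
    term u i j = lookup u i * B i j * lookup z j
    entry : ∀ i j → term (x ⊕ y) i j ≡ term x i j + term y i j
    entry i j rewrite VecP.lookup-zipWith _+_ i x y =
      solve 4 (λ a b c d → (a :+ b) :* c :* d := a :* c :* d :+ b :* c :* d) refl
        (lookup x i) (lookup y i) (B i j) (lookup z j)

  ⟪⟫-scaleˡ : ∀ c x z → ⟪ c · x , z ⟫ ≡ c * ⟪ x , z ⟫
  ⟪⟫-scaleˡ c x z =
    trans (Σᶠ-cong λ i → trans (Σᶠ-cong (entry i)) (Σᶠ-* c (term i)))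
          (Σᶠ-* c (λ i → Σᶠ (term i)))
    where
    term : ∀ i j → ℚ
    term i j = lookup x i * B i j * lookup z j
    entry : ∀ i j → lookup (c · x) i * B i j * lookup z j ≡ c * term i j
    entry i j rewrite VecP.lookup-map i (c *_) x =
      solve 4 (λ a b c d → a :* b :* c :* d := a :* (b :* c :* d)) refl
        c (lookup x i) (B i j) (lookup z j)

  ⟪⟫-zeroˡ : ∀ z → ⟪ zeroV n , z ⟫ ≡ 0ℚ
  ⟪⟫-zeroˡ z = trans (Σᶠ-cong λ i → trans (Σᶠ-cong (entry i)) (Σᶠ-0 {n})) (Σᶠ-0 {n})
    where
    entry : ∀ i j → lookup (zeroV n) i * B i j * lookup z j ≡ 0ℚ
    entry i j rewrite VecP.lookup-replicate i 0ℚ =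
      trans (cong (_* lookup z j) (ℚP.*-zeroˡ (B i j))) (ℚP.*-zeroˡ (lookup z j))

  ⟪⟫-linFinˡ : ∀ {m} (c : Fin m → ℚ) (v : Fin m → V n) z →
    ⟪ linFin c v , z ⟫ ≡ Σᶠ (λ i → c i * ⟪ v i , z ⟫)
  ⟪⟫-linFinˡ {zero}  c v z = ⟪⟫-zeroˡ z
  ⟪⟫-linFinˡ {suc m} c v z =
    trans (⟪⟫-distribˡ-⊕ (c zero · v zero) (linFin (c ∘ suc) (v ∘ suc)) z)
          (cong₂ _+_ (⟪⟫-scaleˡ (c zero) (v zero) z) (⟪⟫-linFinˡ (c ∘ suc) (v ∘ suc) z))

  module Symmetric (B-sym : ∀ i j → B i j ≡ B j i) where

    ⟪⟫-sym : ∀ x y → ⟪ x , y ⟫ ≡ ⟪ y , x ⟫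
    ⟪⟫-sym x y = trans (Σᶠ-swap (λ i j → lookup x i * B i j * lookup y j))
                       (Σᶠ-cong λ j → Σᶠ-cong λ i → entry i j)
      where
      entry : ∀ i j → lookup x i * B i j * lookup y j ≡ lookup y j * B j i * lookup x i
      entry i j rewrite B-sym i j =
        solve 3 (λ a b c → a :* b :* c := c :* b :* a) refl (lookup x i) (B j i) (lookup y j)

    ⟪⟫-distribʳ-⊕ : ∀ x y z → ⟪ z , x ⊕ y ⟫ ≡ ⟪ z , x ⟫ + ⟪ z , y ⟫
    ⟪⟫-distribʳ-⊕ x y z = trans (⟪⟫-sym z (x ⊕ y))
      (trans (⟪⟫-distribˡ-⊕ x y z) (cong₂ _+_ (⟪⟫-sym x z) (⟪⟫-sym y z)))

    ⟪⟫-scaleʳ : ∀ c x z → ⟪ z , c · x ⟫ ≡ c * ⟪ z , x ⟫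
    ⟪⟫-scaleʳ c x z = trans (⟪⟫-sym z (c · x))
      (trans (⟪⟫-scaleˡ c x z) (cong (c *_) (⟪⟫-sym x z)))

    norm-⊕ : ∀ x y → ⟪ x ⊕ y , x ⊕ y ⟫ ≡ ⟪ x , x ⟫ + (⟪ x , y ⟫ + ⟪ x , y ⟫) + ⟪ y , y ⟫
    norm-⊕ x y = begin
      ⟪ x ⊕ y , x ⊕ y ⟫
        ≡⟨ ⟪⟫-distribˡ-⊕ x y (x ⊕ y) ⟩
      ⟪ x , x ⊕ y ⟫ + ⟪ y , x ⊕ y ⟫
        ≡⟨ cong₂ _+_ (⟪⟫-distribʳ-⊕ x y x) (⟪⟫-distribʳ-⊕ x y y) ⟩
      (⟪ x , x ⟫ + ⟪ x , y ⟫) + (⟪ y , x ⟫ + ⟪ y , y ⟫)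
        ≡⟨ cong (λ t → (⟪ x , x ⟫ + ⟪ x , y ⟫) + (t + ⟪ y , y ⟫)) (⟪⟫-sym y x) ⟩
      (⟪ x , x ⟫ + ⟪ x , y ⟫) + (⟪ x , y ⟫ + ⟪ y , y ⟫)
        ≡⟨ solve 3 (λ a b c → (a :+ b) :+ (b :+ c) := a :+ (b :+ b) :+ c) refl
             ⟪ x , x ⟫ ⟪ x , y ⟫ ⟪ y , y ⟫ ⟩
      ⟪ x , x ⟫ + (⟪ x , y ⟫ + ⟪ x , y ⟫) + ⟪ y , y ⟫
        ∎
      where open ≡-Reasoning

linFin-zero : ∀ {n m} (c : Fin m → ℚ) (v : Fin m → V n) → (∀ i → c i ≡ 0ℚ) → linFin c v ≡ zeroV n
linFin-zero {n} {zero}  c v c≡0 = refl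
linFin-zero {n} {suc m} c v c≡0
  rewrite c≡0 zero | linFin-zero (c ∘ suc) (v ∘ suc) (c≡0 ∘ suc) = 0·v⊕0≡0 (v zero)
  where
  0·v⊕0≡0 : ∀ {k} (u : V k) → (0ℚ · u) ⊕ zeroV k ≡ zeroV k
  0·v⊕0≡0 []      = refl
  0·v⊕0≡0 (x ∷ u) = cong₂ _∷_ (cong (_+ 0ℚ) (ℚP.*-zeroˡ x)) (0·v⊕0≡0 u)

module Termination {n : ℕ} (R : RootSystem n) where
  open RootSystem R
  open Bilinear B
  open Symmetric B-sym

  norm-nonneg : ∀ x → 0ℚ ≤ ⟪ x , x ⟫
  norm-nonneg x with VecP.≡-dec ℚP._≟_ x (zeroV n)
  ... | yes refl = ℚP.≤-reflexive (sym (⟪⟫-zeroˡ (zeroV n)))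
  ... | no x≢0   = ℚP.<⇒≤ (B-posdef x x≢0)

  root-norm-pos : ∀ {α} → α ∈ Φ → 0ℚ < ⟪ α , α ⟫
  root-norm-pos {α} α∈Φ = B-posdef α (λ α≡0 → 0∉Φ (subst (_∈ Φ) α≡0 α∈Φ))

  coroot-pairing : ∀ x {α} → α ∈ Φ → ⟨ x , α ∨⟩ * ⟪ α , α ⟫ ≡ ⟪ x , α ⟫ + ⟪ x , α ⟫
  coroot-pairing x {α} α∈Φ with ⟪ α , α ⟫ ℚP.≟ 0ℚ
  ... | yes |α|²≡0 = ⊥-elim (ℚP.<⇒≢ (root-norm-pos α∈Φ) (sym |α|²≡0))
  ... | no |α|²≢0 = begin
    (2x * 1/ ⟪ α , α ⟫) * ⟪ α , α ⟫  ≡⟨ ℚP.*-assoc 2x (1/ ⟪ α , α ⟫) ⟪ α , α ⟫ ⟩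
    2x * (1/ ⟪ α , α ⟫ * ⟪ α , α ⟫)  ≡⟨ cong (2x *_) (ℚP.*-inverseˡ ⟪ α , α ⟫) ⟩
    2x * 1ℚ                          ≡⟨ ℚP.*-identityʳ 2x ⟩
    2x                               ≡⟨ solve 1 (λ p → con (+ 2 ℚ./ 1) :* p := p :+ p) refl ⟪ x , α ⟫ ⟩
    ⟪ x , α ⟫ + ⟪ x , α ⟫            ∎
    where
    open ≡-Reasoning
    instance _ = ℚ.≢-nonZero |α|²≢0
    2x = (+ 2 ℚ./ 1) * ⟪ x , α ⟫

  BoundedStep : (V n → ℕ) → V n → V n → Set
  BoundedStep k λ' μ = ∃ λ α → Φ⁺ α × μ ≡ λ' ⊕ α ×
    ∃ λ (m : ℤ) → ⟨ λ' , α ∨⟩ ≡ ℤ→ℚ m × (m ℤ.+ + 1 ℤ.≤ + k α)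

  sym⇒bounded : ∀ k λ' μ → SymStep k λ' μ → BoundedStep k λ' μ
  sym⇒bounded _ _ _ (α , α⁺ , μ≡ , m , pairing , _ , upper) = α , α⁺ , μ≡ , m , pairing , upper

  tr⇒bounded : ∀ k λ' μ → TrStep k λ' μ → BoundedStep k λ' μ
  tr⇒bounded _ _ _ (α , α⁺ , μ≡ , m , pairing , _ , upper) = α , α⁺ , μ≡ , m , pairing , upper

  terminating-⊆ : ∀ {ω} {Q S : V n → V n → Set} → (∀ x y → Q x y → S x y) →
    TerminatingOnP ω S → TerminatingOnP ω Q
  terminating-⊆ Q⊆S S-term (seq , inP , chain) = S-term (seq , inP , λ i → Q⊆S (seq i) (seq (suc i)) (chain i))

  module Height (ω : Fin n → V n) (fundamental : IsFundamentalWeights ω) where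

    weight-diag : ∀ j → ⟪ ω j , Δ j ⟫ + ⟪ ω j , Δ j ⟫ ≡ ⟪ Δ j , Δ j ⟫
    weight-diag j = begin
      ⟪ ω j , Δ j ⟫ + ⟪ ω j , Δ j ⟫      ≡⟨ coroot-pairing (ω j) (Δ⊆Φ j) ⟨
      ⟨ ω j , Δ j ∨⟩ * ⟪ Δ j , Δ j ⟫   ≡⟨ cong (_* ⟪ Δ j , Δ j ⟫) (proj₁ (fundamental j j) refl) ⟩
      1ℚ * ⟪ Δ j , Δ j ⟫               ≡⟨ ℚP.*-identityˡ ⟪ Δ j , Δ j ⟫ ⟩
      ⟪ Δ j , Δ j ⟫                    ∎
      where open ≡-Reasoning

    weight-offdiag : ∀ i j → i ≢ j → ⟪ ω i , Δ j ⟫ ≡ 0ℚ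
    weight-offdiag i j i≢j = double≡0⇒≡0 (begin
      ⟪ ω i , Δ j ⟫ + ⟪ ω i , Δ j ⟫      ≡⟨ coroot-pairing (ω i) (Δ⊆Φ j) ⟨
      ⟨ ω i , Δ j ∨⟩ * ⟪ Δ j , Δ j ⟫   ≡⟨ cong (_* ⟪ Δ j , Δ j ⟫) (proj₂ (fundamental i j) i≢j) ⟩
      0ℚ * ⟪ Δ j , Δ j ⟫               ≡⟨ ℚP.*-zeroˡ ⟪ Δ j , Δ j ⟫ ⟩
      0ℚ                               ∎)
      where open ≡-Reasoning

    weight-nonZero : ∀ i → ℚ.NonZero ⟪ ω i , Δ i ⟫
    weight-nonZero i = ℚ.≢-nonZero λ (⟪ωᵢ,αᵢ⟫≡0 : ⟪ ω i , Δ i ⟫ ≡ 0ℚ) →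
      ℚP.<⇒≢ (root-norm-pos (Δ⊆Φ i)) (sym (begin
        ⟪ Δ i , Δ i ⟫                  ≡⟨ weight-diag i ⟨
        ⟪ ω i , Δ i ⟫ + ⟪ ω i , Δ i ⟫  ≡⟨ cong (λ t → t + t) ⟪ωᵢ,αᵢ⟫≡0 ⟩
        0ℚ + 0ℚ                        ≡⟨ ℚP.+-identityʳ 0ℚ ⟩
        0ℚ                             ∎))
      where open ≡-Reasoning

    η : V n
    η = linFin (λ i → (1/ ⟪ ω i , Δ i ⟫) {{weight-nonZero i}}) ω

    η-simple : ∀ j → ⟪ Δ j , η ⟫ ≡ 1ℚ
    η-simple j = begin
      ⟪ Δ j , η ⟫                                  ≡⟨ ⟪⟫-sym (Δ j) η ⟩
      ⟪ η , Δ j ⟫                                  ≡⟨ ⟪⟫-linFinˡ _ ω (Δ j) ⟩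
      Σᶠ (λ i → 1/ ⟪ ω i , Δ i ⟫ * ⟪ ω i , Δ j ⟫)  ≡⟨ Σᶠ-single _ j off-diagonal ⟩
      1/ ⟪ ω j , Δ j ⟫ * ⟪ ω j , Δ j ⟫             ≡⟨ ℚP.*-inverseˡ ⟪ ω j , Δ j ⟫ ⟩
      1ℚ                                           ∎
      where
      open ≡-Reasoning
      instance
        nonZero : ∀ {i} → ℚ.NonZero ⟪ ω i , Δ i ⟫
        nonZero = weight-nonZero _
      off-diagonal : ∀ i → i ≢ j → 1/ ⟪ ω i , Δ i ⟫ * ⟪ ω i , Δ j ⟫ ≡ 0ℚ
      off-diagonal i i≢j = trans (cong (1/ ⟪ ω i , Δ i ⟫ *_) (weight-offdiag i j i≢j))
                                 (ℚP.*-zeroʳ (1/ ⟪ ω i , Δ i ⟫))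

    height-≥1 : ∀ {α} → Φ⁺ α → 1ℚ ≤ ⟪ α , η ⟫
    height-≥1 {α} (α∈Φ , c , refl) with Σᶠ-ℕ-≥1-or-zero c
    ... | inj₁ ht≥1 = subst (1ℚ ≤_) (sym height) ht≥1
      where
      height : ⟪ α , η ⟫ ≡ Σᶠ (λ i → ℕ→ℚ (c i))
      height = trans (⟪⟫-linFinˡ (λ i → ℕ→ℚ (c i)) Δ η)
        (Σᶠ-cong λ i → trans (cong (ℕ→ℚ (c i) *_) (η-simple i)) (ℚP.*-identityʳ (ℕ→ℚ (c i))))
    ... | inj₂ c≡0 = ⊥-elim (0∉Φ (subst (_∈ Φ) (linFin-zero _ Δ (cong ℕ→ℚ ∘ c≡0)) α∈Φ))

  module Potential (k : V n → ℕ) (η : V n) (height-≥1 : ∀ {α} → Φ⁺ α → 1ℚ ≤ ⟪ α , η ⟫) where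

    cost : V n → ℚ
    cost β = ⟪ β , β ⟫ * ℕ→ℚ (k β)

    cost-nonneg : ∀ β → 0ℚ ≤ cost β
    cost-nonneg β = 0≤* (norm-nonneg β) (ℕ→ℚ-nonneg (k β))

    C : ℚ
    C = Σˡ cost Φ

    M : ℚ
    M = C + 1ℚ

    M-nonneg : 0ℚ ≤ M
    M-nonneg = 0≤+ (Σˡ-nonneg cost cost-nonneg Φ) (ℚP.<⇒≤ (ℚP.positive⁻¹ 1ℚ))

    shift : V n
    shift = (- M) · η

    G : V n → ℚ
    G x = ⟪ x ⊕ shift , x ⊕ shift ⟫

    G-⊕ : ∀ l α → G (l ⊕ α) ≡
      G l + ((⟪ l , α ⟫ + ⟪ l , α ⟫) + ⟪ α , α ⟫ + (⟪ α , shift ⟫ + ⟪ α , shift ⟫))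
    G-⊕ l α = begin
      G (l ⊕ α)
        ≡⟨ norm-⊕ (l ⊕ α) shift ⟩
      ⟪ l ⊕ α , l ⊕ α ⟫ + (⟪ l ⊕ α , shift ⟫ + ⟪ l ⊕ α , shift ⟫) + ⟪ shift , shift ⟫
        ≡⟨ cong₂ (λ a b → a + (b + b) + ⟪ shift , shift ⟫) (norm-⊕ l α) (⟪⟫-distribˡ-⊕ l α shift) ⟩
      ⟪ l , l ⟫ + (⟪ l , α ⟫ + ⟪ l , α ⟫) + ⟪ α , α ⟫
        + ((⟪ l , shift ⟫ + ⟪ α , shift ⟫) + (⟪ l , shift ⟫ + ⟪ α , shift ⟫)) + ⟪ shift , shift ⟫
        ≡⟨ solve 6 (λ a b c d e f → a :+ (b :+ b) :+ c :+ ((d :+ e) :+ (d :+ e)) :+ f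
                    := a :+ (d :+ d) :+ f :+ ((b :+ b) :+ c :+ (e :+ e))) refl
             ⟪ l , l ⟫ ⟪ l , α ⟫ ⟪ α , α ⟫ ⟪ l , shift ⟫ ⟪ α , shift ⟫ ⟪ shift , shift ⟫ ⟩
      ⟪ l , l ⟫ + (⟪ l , shift ⟫ + ⟪ l , shift ⟫) + ⟪ shift , shift ⟫
        + ((⟪ l , α ⟫ + ⟪ l , α ⟫) + ⟪ α , α ⟫ + (⟪ α , shift ⟫ + ⟪ α , shift ⟫))
        ≡⟨ cong (_+ ((⟪ l , α ⟫ + ⟪ l , α ⟫) + ⟪ α , α ⟫ + (⟪ α , shift ⟫ + ⟪ α , shift ⟫)))
             (sym (norm-⊕ l shift)) ⟩
      G l + ((⟪ l , α ⟫ + ⟪ l , α ⟫) + ⟪ α , α ⟫ + (⟪ α , shift ⟫ + ⟪ α , shift ⟫))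
        ∎
      where open ≡-Reasoning

    -- The drop G(l) - G(l+α) - 1 splits into four nonnegative slacks:
    -- |α|²(k(α) - t - 1), C - |α|²k(α), M(ht α - 1) and M ht α, where t = ⟨l,α^∨⟩.
    potential-drop : ∀ {l μ} → BoundedStep k l μ → G μ + 1ℚ ≤ G l
    potential-drop {l} (α , α⁺@(α∈Φ , _) , refl , m , pairing , upper) =
      subst (_≤ G l) (sym after-step) (0≤-⇒≤ (subst (0ℚ ≤_) (sym slack) slack-nonneg))
      where
      c = ⟪ α , α ⟫
      t = ℤ→ℚ m
      h = ⟪ α , η ⟫
      K = ℕ→ℚ (k α)
      after-step : G (l ⊕ α) + 1ℚ ≡ G l + (t * c + c + ((- M) * h + (- M) * h)) + 1ℚ
      after-step = cong (_+ 1ℚ) (trans (G-⊕ l α)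
        (cong₂ (λ u v → G l + (u + c + (v + v)))
               (trans (sym (coroot-pairing l α∈Φ)) (cong (_* c) pairing))
               (⟪⟫-scaleʳ (- M) η α)))
      slack : G l - (G l + (t * c + c + ((- M) * h + (- M) * h)) + 1ℚ)
            ≡ (c * K - c * (t + 1ℚ)) + (C - c * K) + (M * h - M * 1ℚ) + M * h
      slack = solve 6 (λ g t c h K C →
                g :- (g :+ (t :* c :+ c :+ ((:- (C :+ con 1ℚ)) :* h :+ (:- (C :+ con 1ℚ)) :* h)) :+ con 1ℚ)
                := (c :* K :- c :* (t :+ con 1ℚ)) :+ (C :- c :* K)
                   :+ ((C :+ con 1ℚ) :* h :- (C :+ con 1ℚ) :* con 1ℚ) :+ (C :+ con 1ℚ) :* h)
              refl (G l) t c h K C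
      t+1≤K : t + 1ℚ ≤ K
      t+1≤K = subst (_≤ K) (sym (ℤ→ℚ-+ m (+ 1))) (ℤ→ℚ-mono upper)
      slack-nonneg : 0ℚ ≤ (c * K - c * (t + 1ℚ)) + (C - c * K) + (M * h - M * 1ℚ) + M * h
      slack-nonneg = 0≤+ (0≤+ (0≤+
        (≤⇒0≤- (ℚP.*-monoˡ-≤-nonNeg c {{ℚ.nonNegative (norm-nonneg α)}} t+1≤K))
        (≤⇒0≤- (term≤Σˡ cost cost-nonneg α∈Φ)))
        (≤⇒0≤- (ℚP.*-monoˡ-≤-nonNeg M {{ℚ.nonNegative M-nonneg}} (height-≥1 α⁺))))
        (0≤* M-nonneg (ℚP.≤-trans (ℚP.<⇒≤ (ℚP.positive⁻¹ 1ℚ)) (height-≥1 α⁺)))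

    bounded-terminating : ∀ {ω} → TerminatingOnP ω (BoundedStep k)
    bounded-terminating (seq , _ , chain) =
      no-infinite-descent (BoundedStep k) G (λ x → norm-nonneg (x ⊕ shift)) potential-drop (seq , chain)

proposition4p3 : ∀ {n : ℕ} (R : RootSystem n) (ω : Fin n → V n) →
    RootSystem.IsFundamentalWeights R ω →
    ∀ (k : V n → ℕ) → RootSystem.IsWInvariant R k →
    RootSystem.TerminatingOnP R ω (RootSystem.SymStep R k) ×
    RootSystem.TerminatingOnP R ω (RootSystem.TrStep R k)
proposition4p3 R ω fundamental k _ =
  terminating-⊆ (sym⇒bounded k) bounded-terminating ,
  terminating-⊆ (tr⇒bounded k) bounded-terminating
  where
  open Termination R
  open Height ω fundamental
  open Potential k η height-≥1
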